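{- For all $n\ge0$ and $k\ge0$, the number of permutations $\pi\in\mathcal S_n$ with exactly $k$ valleys equals the number of cyclic permutations (permutations consisting of a single cycle) of $[n+1]$ with exactly $k$ cyclic valleys.
   Context: $\mathcal S_n$ is the set of permutations of $[n]$ ($\mathcal S_0$ contains only the empty permutation). A valley of $\pi$ (one-line notation) is an index $i$ with $\pi(i+1)<\pi(i)$ and $\pi(i+1)<\pi(i+2)$. For a single cycle of $[n+1]$ written as $(c_1c_2\cdots c_{n+1})$ with $c_1=1$, a cyclic valley is an index $i$ with $c_{i+1}<c_i$ and $c_{i+1}<c_{i+2}$ ($1\le i\le n-1$). -}

module Defs where

open import Data.Nat using (ℕ; zero; suc; _+_; _<ᵇ_)
open import Data.Bool using (Bool; true; false; _∧_; if_then_else_)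
open import Data.List using (List; []; _∷_; length; map; upTo)
open import Data.List.Membership.Propositional using (_∈_)
open import Data.List.Relation.Unary.Unique.Propositional using (Unique)
open import Data.List.Relation.Binary.Permutation.Propositional using (_↭_)
open import Data.Product using (Σ; _×_)
open import Function.Bundles using (_⇔_)
open import Relation.Binary.PropositionalEquality using (_≡_)

[_] : ℕ → List ℕ
[ n ] = map suc (upTo n)

-- A permutation of [n] in one-line notation π(1) π(2) … π(n).
IsPerm : ℕ → List ℕ → Set
IsPerm n π = π ↭ [ n ]

valleys : List ℕ → ℕ
valleys (a ∷ b ∷ c ∷ rest) =
  (if (b <ᵇ a) ∧ (b <ᵇ c) then 1 else 0) + valleys (b ∷ c ∷ rest)
valleys _ = 0

-- σ(i) for a one-line word σ (1-indexed; 0 outside the range).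
at : List ℕ → ℕ → ℕ
at []      _             = 0
at (x ∷ _) 1             = x
at (_ ∷ xs) (suc (suc i)) = at xs (suc i)
at (_ ∷ _) zero          = 0

orbit : List ℕ → ℕ → ℕ → List ℕ
orbit σ zero    x = []
orbit σ (suc m) x = x ∷ orbit σ m (at σ x)

cycleWord : List ℕ → List ℕ
cycleWord σ = orbit σ (length σ) 1

-- σ ∈ S_N is cyclic (a single N-cycle) iff the orbit of 1 runs through all of [N].
IsCyclicPerm : ℕ → List ℕ → Set
IsCyclicPerm N σ = IsPerm N σ × (cycleWord σ ↭ [ N ])

-- Cyclic valleys of a cyclic permutation: valleys of its cycle word (c₁ … c_N),
-- i.e. indices 1 ≤ i ≤ N-2 with c(i+1) < c(i) and c(i+1) < c(i+2).
cycValleys : List ℕ → ℕ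
cycValleys σ = valleys (cycleWord σ)

HasCount : (List ℕ → Set) → ℕ → Set
HasCount P m = Σ (List (List ℕ)) λ L → Unique L × ((x : List ℕ) → (x ∈ L) ⇔ P x) × (length L ≡ m)

module Submission where

-- Read (1, π(1)+1, …, π(n)+1) as the cycle of a permutation of [n+1]. This is a bijection from
-- S_n onto the cyclic permutations of [n+1]: a cyclic permutation is recovered from its cycle
-- word, since it sends every entry of the word to the next one and the last entry back to 1 (the
-- other entries are already the images of their predecessors, so 1 must be the image of the
-- last). Prepending 1 and shifting every other letter up by one neither creates nor destroys a
-- valley, so the valleys of π are exactly the cyclic valleys of its image.

open import Defs
open import Data.Bool using (if_then_else_)
open import Data.List
  using (List; []; _∷_; _++_; _∷ʳ_; map; length; filter; applyUpTo; upTo; cartesianProductWith;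
         initLast; _∷ʳ′_)
open import Data.List.Properties
  using (∷-injective; ∷-injectiveˡ; ∷-injectiveʳ; map-injective; map-++; map-∘; map-cong-local;
         map-applyUpTo; length-map; length-applyUpTo)
open import Data.List.Membership.Propositional using (_∈_)
open import Data.List.Membership.Propositional.Properties
  using (∈-map⁻; ∈-map⁺; ∈-upTo⁻; ∈-∃++; ∈-filter⁺; ∈-filter⁻; ∈-cartesianProductWith⁺)
import Data.List.Membership.DecPropositional
open import Data.List.Relation.Unary.All using (All; []; _∷_; tabulate)
import Data.List.Relation.Unary.All as All
open import Data.List.Relation.Unary.AllPairs using ([]; _∷_)
open import Data.List.Relation.Unary.Any using (here; there)
open import Data.List.Relation.Unary.Linked using (Linked; []; [-]; _∷_)
open import Data.List.Relation.Unary.Unique.Propositional using (Unique)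
import Data.List.Relation.Unary.Unique.Propositional.Properties as Unique
open import Data.List.Relation.Binary.Permutation.Propositional
  using (_↭_; prep; ↭-refl; ↭-sym; ↭-trans; ↭-reflexive; ↭⇒↭ₛ; module PermutationReasoning)
open import Data.List.Relation.Binary.Permutation.Propositional.Properties
  using (↭-empty-inv; ↭-singleton-inv; ↭-length; ↭-map-inv; ∈-resp-↭; map⁺; shift; drop-mid;
         drop-∷; ++-comm)
open import Data.Nat using (ℕ; zero; suc; _+_; _<_; s≤s; _≟_)
open import Data.Nat.Properties using (suc-injective)
open import Data.Product using (Σ; ∃; _×_; _,_; proj₂)
open import Function using (_∘_; case_of_)
open import Function.Bundles using (_⇔_; mk⇔; Equivalence)
open import Relation.Binary.Definitions using (DecidableEquality)
open import Relation.Binary.PropositionalEquality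
  using (_≡_; _≢_; refl; sym; trans; cong; subst; module ≡-Reasoning)
open import Relation.Binary.PropositionalEquality.Properties using () renaming (setoid to ≡-setoid)
open import Data.List.Relation.Binary.Permutation.Setoid.Properties (≡-setoid ℕ)
  using (Unique-resp-↭)
open import Relation.Nullary using (Dec; yes; no; does)
open import Relation.Nullary.Decidable using (dec-true; dec-false)
open import Relation.Unary using (Decidable)

module _ {a} {A : Set a} where

  ++-cancelˡ-↭ : ∀ xs {ys zs : List A} → xs ++ ys ↭ xs ++ zs → ys ↭ zs
  ++-cancelˡ-↭ []       p = p
  ++-cancelˡ-↭ (x ∷ xs) p = ++-cancelˡ-↭ xs (drop-∷ p)

  Iterates : (A → A) → List A → Set a
  Iterates f = Linked (λ x y → f x ≡ y)

  module _ {f : A → A} where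

    Iterates-∷ʳ⁺ : ∀ xs {y z} → Iterates f (xs ∷ʳ y) → f y ≡ z → Iterates f (xs ∷ʳ y ∷ʳ z)
    Iterates-∷ʳ⁺ []           [-]      e′ = e′ ∷ [-]
    Iterates-∷ʳ⁺ (_ ∷ [])     (e ∷ it) e′ = e ∷ Iterates-∷ʳ⁺ [] it e′
    Iterates-∷ʳ⁺ (_ ∷ x ∷ xs) (e ∷ it) e′ = e ∷ Iterates-∷ʳ⁺ (x ∷ xs) it e′

    map-iterates : ∀ {x} xs {y} → Iterates f (x ∷ xs ∷ʳ y) → map f (x ∷ xs) ≡ xs ∷ʳ y
    map-iterates []       (e ∷ [-]) = cong (_∷ []) e
    map-iterates (z ∷ zs) (e ∷ it)  rewrite e = cong (z ∷_) (map-iterates zs it)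

    map-cycle-↭ : ∀ {x} xs → Iterates f (x ∷ xs ∷ʳ x) → map f (x ∷ xs) ↭ x ∷ xs
    map-cycle-↭ {x} xs it = ↭-trans (↭-reflexive (map-iterates xs it)) (++-comm xs (x ∷ []))

    -- f maps the path onto ys ∷ʳ y ∷ʳ f y, and cancelling the common part of the two
    -- multisets leaves f y against x.
    iterates-return : ∀ {x} ys {y} → Iterates f (x ∷ ys ∷ʳ y) →
                      map f (x ∷ ys ∷ʳ y) ↭ x ∷ ys ∷ʳ y → f y ≡ x
    iterates-return {x} ys {y} it p =
      ∷-injectiveˡ (↭-singleton-inv (++-cancelˡ-↭ (ys ∷ʳ y) (begin
        (ys ∷ʳ y) ∷ʳ f y      ≡⟨ cong (_∷ʳ f y) (map-iterates ys it) ⟨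
        map f (x ∷ ys) ∷ʳ f y ≡⟨ map-++ f (x ∷ ys) (y ∷ []) ⟨
        map f (x ∷ ys ∷ʳ y)   ↭⟨ p ⟩
        x ∷ ys ∷ʳ y           ↭⟨ ++-comm (x ∷ []) (ys ∷ʳ y) ⟩
        (ys ∷ʳ y) ∷ʳ x        ∎)))
      where open PermutationReasoning

    iterates-close : ∀ {x} xs → Iterates f (x ∷ xs) → map f (x ∷ xs) ↭ x ∷ xs →
                     Iterates f (x ∷ xs ∷ʳ x)
    iterates-close xs it p with initLast xs
    ... | []       = ∷-injectiveˡ (↭-singleton-inv p) ∷ [-]
    ... | ys ∷ʳ′ y = Iterates-∷ʳ⁺ (_ ∷ ys) it (iterates-return ys it p)

  module _ {f g : A → A} where

    iterates-agree : ∀ xs {y} → Iterates f (xs ∷ʳ y) → Iterates g (xs ∷ʳ y) →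
                     ∀ {a} → a ∈ xs → f a ≡ g a
    iterates-agree (x ∷ [])     (e ∷ _)  (e′ ∷ _)  (here refl) = trans e (sym e′)
    iterates-agree (x ∷ z ∷ zs) (e ∷ _)  (e′ ∷ _)  (here refl) = trans e (sym e′)
    iterates-agree (x ∷ z ∷ zs) (_ ∷ it) (_ ∷ it′) (there a∈) = iterates-agree (z ∷ zs) it it′ a∈

    iterates-cong : ∀ xs {y} → (∀ {a} → a ∈ xs → f a ≡ g a) →
                    Iterates f (xs ∷ʳ y) → Iterates g (xs ∷ʳ y)
    iterates-cong []           f≗g [-]       = [-]
    iterates-cong (x ∷ [])     f≗g (e ∷ [-]) = trans (sym (f≗g (here refl))) e ∷ [-]
    iterates-cong (x ∷ z ∷ zs) f≗g (e ∷ it)  =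
      trans (sym (f≗g (here refl))) e ∷ iterates-cong (z ∷ zs) (f≗g ∘ there) it

module _ {a} {A : Set a} (_≟ᴬ_ : DecidableEquality A) where

  open Data.List.Membership.DecPropositional _≟ᴬ_ using (_∈?_)

  ↭-dec : (xs ys : List A) → Dec (xs ↭ ys)
  ↭-dec []       []       = yes ↭-refl
  ↭-dec []       (y ∷ ys) = no λ p → case ↭-empty-inv (↭-sym p) of λ ()
  ↭-dec (x ∷ xs) ys with x ∈? ys
  ... | no x∉ = no λ p → x∉ (∈-resp-↭ p (here refl))
  ... | yes x∈ with ys₁ , ys₂ , refl ← ∈-∃++ x∈ with ↭-dec xs (ys₁ ++ ys₂)
  ...   | yes p = yes (↭-trans (prep x p) (↭-sym (shift x ys₁ ys₂)))
  ...   | no ¬p = no (¬p ∘ drop-mid [] ys₁)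

  -- Successor in the word c, wrapping around to h; the value is also h for every y off c.
  succIn : A → List A → A → A
  succIn h (a ∷ b ∷ r) y = if does (a ≟ᴬ y) then b else succIn h (b ∷ r) y
  succIn h _           y = h

  succIn-iterates : ∀ h c → Unique c → Iterates (succIn h c) (c ∷ʳ h)
  succIn-iterates h []          _            = [-]
  succIn-iterates h (a ∷ [])    _            = refl ∷ [-]
  succIn-iterates h (a ∷ b ∷ r) (a∉ ∷ b∷r!) =
    succIn-head ∷ iterates-cong (b ∷ r) succIn-tail (succIn-iterates h (b ∷ r) b∷r!)
    where
    succIn-head : succIn h (a ∷ b ∷ r) a ≡ b
    succIn-head rewrite dec-true (a ≟ᴬ a) refl = refl
    succIn-tail : ∀ {y} → y ∈ b ∷ r → succIn h (b ∷ r) y ≡ succIn h (a ∷ b ∷ r) y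
    succIn-tail {y} y∈ rewrite dec-false (a ≟ᴬ y) (All.lookup a∉ y∈) = refl

length-[] : ∀ N → length [ N ] ≡ N
length-[] N = trans (length-map suc (upTo N)) (length-applyUpTo (λ i → i) N)

map-[] : ∀ (g : ℕ → ℕ) N → map g [ N ] ≡ applyUpTo (g ∘ suc) N
map-[] g N = trans (sym (map-∘ (upTo N))) (map-applyUpTo (λ i → i) (g ∘ suc) N)

[suc]≡1∷map-suc : ∀ n → [ suc n ] ≡ 1 ∷ map suc [ n ]
[suc]≡1∷map-suc n = cong (λ w → 1 ∷ map suc w) (sym (map-applyUpTo (λ i → i) suc n))

Unique-[] : ∀ N → Unique [ N ]
Unique-[] N = Unique.map⁺ suc-injective (Unique.upTo⁺ N)

↭-[]⇒Unique : ∀ {c N} → c ↭ [ N ] → Unique c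
↭-[]⇒Unique p = Unique-resp-↭ (↭⇒↭ₛ (↭-sym p)) (Unique-[] _)

at-applyUpTo : ∀ (h : ℕ → ℕ) {N j} → j < N → at (applyUpTo h N) (suc j) ≡ h j
at-applyUpTo h {suc N} {zero}  _         = refl
at-applyUpTo h {suc N} {suc j} (s≤s j<N) = at-applyUpTo (h ∘ suc) j<N

at-map-[] : ∀ (g : ℕ → ℕ) {N y} → y ∈ [ N ] → at (map g [ N ]) y ≡ g y
at-map-[] g {N} y∈ with j , j∈ , refl ← ∈-map⁻ suc y∈ =
  trans (cong (λ w → at w (suc j)) (map-[] g N)) (at-applyUpTo (g ∘ suc) (∈-upTo⁻ j∈))

applyUpTo-at : ∀ σ → applyUpTo (at σ ∘ suc) (length σ) ≡ σ
applyUpTo-at []      = refl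
applyUpTo-at (x ∷ σ) = cong (x ∷_) (applyUpTo-at σ)

map-at-[] : ∀ σ → map (at σ) [ length σ ] ≡ σ
map-at-[] σ = trans (map-[] (at σ) (length σ)) (applyUpTo-at σ)

at-ext : ∀ {N} σ τ → length σ ≡ N → length τ ≡ N →
         (∀ {y} → y ∈ [ N ] → at σ y ≡ at τ y) → σ ≡ τ
at-ext σ τ refl |τ|≡|σ| σ≗τ = begin
  σ                          ≡⟨ map-at-[] σ ⟨
  map (at σ) [ length σ ]    ≡⟨ map-cong-local (tabulate σ≗τ) ⟩
  map (at τ) [ length σ ]    ≡⟨ cong (λ N → map (at τ) [ N ]) |τ|≡|σ| ⟨
  map (at τ) [ length τ ]    ≡⟨ map-at-[] τ ⟩
  τ                          ∎
  where open ≡-Reasoning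

orbit-iterates : ∀ σ m x → Iterates (at σ) (orbit σ m x)
orbit-iterates σ zero            x = []
orbit-iterates σ (suc zero)      x = [-]
orbit-iterates σ (suc m@(suc _)) x = refl ∷ orbit-iterates σ m (at σ x)

iterates-orbit : ∀ σ xs {x ys} → Iterates (at σ) (x ∷ xs ++ ys) → orbit σ (suc (length xs)) x ≡ x ∷ xs
iterates-orbit σ []       _            = refl
iterates-orbit σ (z ∷ zs) {x} (e ∷ it) rewrite e = cong (x ∷_) (iterates-orbit σ zs it)

cycleWord-suc : ∀ {n σ} → length σ ≡ suc n → cycleWord σ ≡ 1 ∷ orbit σ n (at σ 1)
cycleWord-suc {σ = σ} |σ| = cong (λ m → orbit σ m 1) |σ|

cyclicPerm : ℕ → List ℕ → List ℕ
cyclicPerm N c = map (succIn _≟_ 1 c) [ N ]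

cyclicPerm-iterates : ∀ {N c} → c ↭ [ N ] → Iterates (at (cyclicPerm N c)) (c ∷ʳ 1)
cyclicPerm-iterates {N} {c} p =
  iterates-cong c (λ y∈ → sym (at-map-[] (succIn _≟_ 1 c) (∈-resp-↭ p y∈)))
    (succIn-iterates _≟_ 1 c (↭-[]⇒Unique p))

cycleWord-cyclicPerm : ∀ {N t} → 1 ∷ t ↭ [ N ] → cycleWord (cyclicPerm N (1 ∷ t)) ≡ 1 ∷ t
cycleWord-cyclicPerm {N} {t} p = begin
  orbit σ (length σ) 1           ≡⟨ cong (λ m → orbit σ m 1) |σ|≡|c| ⟩
  orbit σ (suc (length t)) 1     ≡⟨ iterates-orbit σ t (cyclicPerm-iterates p) ⟩
  1 ∷ t                          ∎
  where
  open ≡-Reasoning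
  σ = cyclicPerm N (1 ∷ t)
  |σ|≡|c| : length σ ≡ suc (length t)
  |σ|≡|c| = trans (length-map _ [ N ]) (trans (length-[] N) (sym (trans (↭-length p) (length-[] N))))

cyclicPerm-isCyclic : ∀ {N t} → 1 ∷ t ↭ [ N ] → IsCyclicPerm N (cyclicPerm N (1 ∷ t))
cyclicPerm-isCyclic {N} {t} p = σ↭ , subst (_↭ [ N ]) (sym (cycleWord-cyclicPerm p)) p
  where
  f = succIn _≟_ 1 (1 ∷ t)
  σ↭ : cyclicPerm N (1 ∷ t) ↭ [ N ]
  σ↭ = begin
    map f [ N ]     ↭⟨ map⁺ f (↭-sym p) ⟩
    map f (1 ∷ t)   ↭⟨ map-cycle-↭ t (succIn-iterates _≟_ 1 (1 ∷ t) (↭-[]⇒Unique p)) ⟩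
    1 ∷ t           ↭⟨ p ⟩
    [ N ]           ∎
    where open PermutationReasoning

IsCyclicPerm-iterates : ∀ {n σ} → IsCyclicPerm (suc n) σ → Iterates (at σ) (cycleWord σ ∷ʳ 1)
IsCyclicPerm-iterates {n} {σ} (σ↭ , c↭) =
  subst (λ c → Iterates (at σ) (c ∷ʳ 1)) (sym c≡)
    (iterates-close xs (subst (Iterates (at σ)) c≡ (orbit-iterates σ (length σ) 1)) map↭)
  where
  |σ| : length σ ≡ suc n
  |σ| = trans (↭-length σ↭) (length-[] (suc n))
  xs = orbit σ n (at σ 1)
  c≡ : cycleWord σ ≡ 1 ∷ xs
  c≡ = cycleWord-suc |σ|
  map↭ : map (at σ) (1 ∷ xs) ↭ 1 ∷ xs
  map↭ = begin
    map (at σ) (1 ∷ xs)         ≡⟨ cong (map (at σ)) c≡ ⟨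
    map (at σ) (cycleWord σ)    ↭⟨ map⁺ (at σ) c↭ ⟩
    map (at σ) [ suc n ]        ≡⟨ cong (λ N → map (at σ) [ N ]) |σ| ⟨
    map (at σ) [ length σ ]     ≡⟨ map-at-[] σ ⟩
    σ                           ↭⟨ ↭-trans σ↭ (↭-sym c↭) ⟩
    cycleWord σ                 ≡⟨ c≡ ⟩
    1 ∷ xs                      ∎
    where open PermutationReasoning

IsCyclicPerm⇒≡cyclicPerm : ∀ {N σ} → IsCyclicPerm (suc N) σ → σ ≡ cyclicPerm (suc N) (cycleWord σ)
IsCyclicPerm⇒≡cyclicPerm {N} {σ} cyc@(σ↭ , c↭) =
  at-ext σ (cyclicPerm (suc N) (cycleWord σ))
    (trans (↭-length σ↭) (length-[] (suc N)))
    (trans (length-map _ [ suc N ]) (length-[] (suc N)))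
    (λ y∈ → iterates-agree (cycleWord σ) (IsCyclicPerm-iterates cyc) (cyclicPerm-iterates c↭)
              (∈-resp-↭ (↭-sym c↭) y∈))

valleys-map-suc : ∀ w → valleys (map suc w) ≡ valleys w
valleys-map-suc (a ∷ b ∷ c ∷ w) = cong (_ +_) (valleys-map-suc (b ∷ c ∷ w))
valleys-map-suc []              = refl
valleys-map-suc (_ ∷ [])        = refl
valleys-map-suc (_ ∷ _ ∷ [])    = refl

valleys-1∷map-suc : ∀ w → valleys (1 ∷ map suc w) ≡ valleys w
valleys-1∷map-suc []          = refl
valleys-1∷map-suc (_ ∷ [])    = refl
valleys-1∷map-suc (a ∷ b ∷ w) = valleys-map-suc (a ∷ b ∷ w)

cyclicOf : ℕ → List ℕ → List ℕ
cyclicOf n π = cyclicPerm (suc n) (1 ∷ map suc π)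

1∷map-suc-↭ : ∀ {n π} → IsPerm n π → 1 ∷ map suc π ↭ [ suc n ]
1∷map-suc-↭ {n} p = ↭-trans (prep 1 (map⁺ suc p)) (↭-reflexive (sym ([suc]≡1∷map-suc n)))

1∷-↭-[suc]-inv : ∀ {n xs} → 1 ∷ xs ↭ [ suc n ] → ∃ λ π → IsPerm n π × xs ≡ map suc π
1∷-↭-[suc]-inv {n} p
  with π , xs≡ , [n]↭π ← ↭-map-inv suc (↭-sym (drop-∷ (↭-trans p (↭-reflexive ([suc]≡1∷map-suc n))))) =
  π , ↭-sym [n]↭π , xs≡

cyclicOf-isCyclic : ∀ {n π} → IsPerm n π → IsCyclicPerm (suc n) (cyclicOf n π)
cyclicOf-isCyclic p = cyclicPerm-isCyclic (1∷map-suc-↭ p)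

cycleWord-cyclicOf : ∀ {n π} → IsPerm n π → cycleWord (cyclicOf n π) ≡ 1 ∷ map suc π
cycleWord-cyclicOf p = cycleWord-cyclicPerm (1∷map-suc-↭ p)

cycValleys-cyclicOf : ∀ {n π} → IsPerm n π → cycValleys (cyclicOf n π) ≡ valleys π
cycValleys-cyclicOf {π = π} p = trans (cong valleys (cycleWord-cyclicOf p)) (valleys-1∷map-suc π)

cyclicOf-injective : ∀ {n π π′} → IsPerm n π → IsPerm n π′ → cyclicOf n π ≡ cyclicOf n π′ → π ≡ π′
cyclicOf-injective p p′ e = map-injective suc-injective (∷-injectiveʳ
  (trans (sym (cycleWord-cyclicOf p)) (trans (cong cycleWord e) (cycleWord-cyclicOf p′))))

cycleWord≡1∷map-suc : ∀ {n σ} → IsCyclicPerm (suc n) σ → ∃ λ π → IsPerm n π × cycleWord σ ≡ 1 ∷ map suc π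
cycleWord≡1∷map-suc {n} {σ} (σ↭ , c↭)
  with c≡ ← cycleWord-suc {n} {σ} (trans (↭-length σ↭) (length-[] (suc n)))
  with π , p , xs≡ ← 1∷-↭-[suc]-inv (subst (_↭ [ suc n ]) c≡ c↭) =
  π , p , trans c≡ (cong (1 ∷_) xs≡)

cyclicOf-surjective : ∀ {n σ} → IsCyclicPerm (suc n) σ → ∃ λ π → IsPerm n π × cyclicOf n π ≡ σ
cyclicOf-surjective {n} cyc with π , p , c≡ ← cycleWord≡1∷map-suc cyc =
  π , p , sym (trans (IsCyclicPerm⇒≡cyclicPerm cyc) (cong (cyclicPerm (suc n)) c≡))

module _ {a} {A : Set a} where

  words : List A → ℕ → List (List A)
  words alphabet zero    = [] ∷ []
  words alphabet (suc m) = cartesianProductWith _∷_ alphabet (words alphabet m)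

  words-unique : ∀ {alphabet} m → Unique alphabet → Unique (words alphabet m)
  words-unique zero    _  = [] ∷ []
  words-unique (suc m) u = Unique.cartesianProductWith⁺ _∷_ ∷-injective u (words-unique m u)

  ∈-words : ∀ {alphabet} w → All (_∈ alphabet) w → w ∈ words alphabet (length w)
  ∈-words []      []         = here refl
  ∈-words (x ∷ w) (x∈ ∷ w⊆) = ∈-cartesianProductWith⁺ _∷_ x∈ (∈-words w w⊆)

module _ {a b} {A : Set a} {B : Set b} {f : A → B} where

  map⁺-Unique-local : ∀ {xs} → (∀ {x y} → x ∈ xs → y ∈ xs → f x ≡ f y → x ≡ y) →
                      Unique xs → Unique (map f xs)
  map⁺-Unique-local {[]}     _   []          = []
  map⁺-Unique-local {x ∷ xs} inj (x∉ ∷ xs!) =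
    tabulate fx∉ ∷ map⁺-Unique-local (λ x∈ y∈ → inj (there x∈) (there y∈)) xs!
    where
    fx∉ : ∀ {z} → z ∈ map f xs → f x ≢ z
    fx∉ z∈ fx≡z with y , y∈ , refl ← ∈-map⁻ f z∈ = All.lookup x∉ y∈ (inj (here refl) (there y∈) fx≡z)

HasCount-∩ : ∀ {P m} {Q : List ℕ → Set} → Decidable Q → HasCount P m → Σ ℕ (HasCount (λ x → P x × Q x))
HasCount-∩ {P} {Q = Q} Q? (L , L! , L⇔P , _) =
  length (filter Q? L) , filter Q? L , Unique.filter⁺ Q? L! , mem , refl
  where
  mem : ∀ x → x ∈ filter Q? L ⇔ (P x × Q x)
  mem x = mk⇔ (λ x∈ → let x∈L , q = ∈-filter⁻ Q? x∈ in Equivalence.to (L⇔P x) x∈L , q)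
              (λ (p , q) → ∈-filter⁺ Q? (Equivalence.from (L⇔P x) p) q)

HasCount-image : ∀ {P Q : List ℕ → Set} {m} (f : List ℕ → List ℕ) →
                 (∀ {x y} → P x → P y → f x ≡ f y → x ≡ y) →
                 (∀ y → Q y ⇔ (∃ λ x → P x × f x ≡ y)) →
                 HasCount P m → HasCount Q m
HasCount-image {P} {Q} f inj Q⇔image (L , L! , L⇔P , |L|) =
  map f L , map⁺-Unique-local (λ x∈ y∈ → inj (to x∈) (to y∈)) L! , mem , trans (length-map f L) |L|
  where
  to : ∀ {x} → x ∈ L → P x
  to {x} = Equivalence.to (L⇔P x)
  mem : ∀ y → y ∈ map f L ⇔ Q y
  mem y = mk⇔
    (λ y∈ → let x , x∈ , y≡ = ∈-map⁻ f y∈ in Equivalence.from (Q⇔image y) (x , to x∈ , sym y≡))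
    (λ q → let x , p , fx≡y = Equivalence.to (Q⇔image y) q in
           subst (_∈ map f L) fx≡y (∈-map⁺ f (Equivalence.from (L⇔P x) p)))

HasCount-IsPerm : ∀ n → Σ ℕ (HasCount (IsPerm n))
HasCount-IsPerm n = length L , L , Unique.filter⁺ isPerm? (words-unique n (Unique-[] n)) , mem , refl
  where
  isPerm? = λ w → ↭-dec _≟_ w [ n ]
  L = filter isPerm? (words [ n ] n)
  mem : ∀ w → w ∈ L ⇔ IsPerm n w
  mem w = mk⇔ (λ w∈ → proj₂ (∈-filter⁻ isPerm? {xs = words [ n ] n} w∈))
              (λ p → ∈-filter⁺ isPerm?
                       (subst (λ m → w ∈ words [ n ] m) (trans (↭-length p) (length-[] n))
                              (∈-words w (tabulate (∈-resp-↭ p))))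
                       p)

mainTheorem9 : (n k : ℕ) → Σ ℕ λ m →
    HasCount (λ π → IsPerm n π × (valleys π ≡ k)) m
      × HasCount (λ σ → IsCyclicPerm (suc n) σ × (cycValleys σ ≡ k)) m
mainTheorem9 n k with m , count ← HasCount-∩ (λ π → valleys π ≟ k) (proj₂ (HasCount-IsPerm n)) =
  m , count , HasCount-image (cyclicOf n) (λ (p , _) (p′ , _) → cyclicOf-injective p p′) image count
  where
  image : ∀ σ → (IsCyclicPerm (suc n) σ × cycValleys σ ≡ k) ⇔
                (∃ λ π → (IsPerm n π × valleys π ≡ k) × cyclicOf n π ≡ σ)
  image σ = mk⇔
    (λ (cyc , v) → case cyclicOf-surjective cyc of λ where
      (π , p , refl) → π , (p , trans (sym (cycValleys-cyclicOf p)) v) , refl)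
    (λ { (π , (p , v) , refl) → cyclicOf-isCyclic p , trans (cycValleys-cyclicOf p) v })
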